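{- For every permutation $\pi$ (as in the context), $d'(\pi)\le b(\pi)-1$.
   Context: A permutation is $\pi=[\pi_0,\pi_1,\ldots,\pi_n,\pi_{n+1}]$ with $\pi_0=0$, $\pi_{n+1}=n+1$ and $(\pi_1,\ldots,\pi_n)$ a permutation of $\{1,\ldots,n\}$. A prefix reversal $\beta(1,j)$, $3\le j\le n+1$, gives $[\pi_0,\pi_{j-1},\ldots,\pi_1,\pi_j,\ldots,\pi_{n+1}]$. A prefix transposition $\tau(1,j,k)$, $2\le j\le n$, $j<k\le n+1$, gives $[\pi_0,\pi_j,\ldots,\pi_{k-1},\pi_1,\ldots,\pi_{j-1},\pi_k,\ldots,\pi_{n+1}]$. A prefix transreversal $\beta\tau(1,j,k)$, same ranges, gives $[\pi_0,\pi_j,\ldots,\pi_{k-1},\pi_{j-1},\ldots,\pi_1,\pi_k,\ldots,\pi_{n+1}]$. The identity has $\pi_i=i$ for all $i$. $d'(\pi)$ is the minimum number of operations (prefix reversals, prefix transpositions, prefix transreversals) transforming $\pi$ into the identity. Breakpoints: position $1$ is always a breakpoint; for $2\le i\le n+1$, position $i$ is a breakpoint iff $|\pi_i-\pi_{i-1}|\neq 1$. $b(\pi)$ is the number of breakpoints. -}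

module Defs where

open import Data.Nat using (ℕ; zero; suc; _+_; _∸_; _≤_; _<_)
open import Data.List using (List; []; _∷_; _++_; take; drop; reverse; length; upTo; map)
open import Data.List.Relation.Binary.Permutation.Propositional using (_↭_)
open import Relation.Binary.PropositionalEquality using (_≡_)
open import Data.Product using (Σ; _×_; _,_; ∃-syntax)
open import Data.Sum using (_⊎_)
open import Data.Bool using (Bool; true; false; if_then_else_)
open import Data.Nat using (_≡ᵇ_)

-- A permutation π = [π₀, π₁, …, πₙ, πₙ₊₁] is represented by the inner list
-- (π₁, …, πₙ); π₀ = 0 and πₙ₊₁ = n+1 are implicit.

oneToN : ℕ → List ℕ
oneToN n = map suc (upTo n)

IsPerm : ℕ → List ℕ → Set
IsPerm n xs = xs ↭ oneToN n

extended : ℕ → List ℕ → List ℕ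
extended n xs = 0 ∷ (xs ++ (suc n ∷ []))

-- prefix reversal β(1,j): reverse π₁ … π_{j-1}
prefixRev : ℕ → List ℕ → List ℕ
prefixRev j xs = reverse (take (j ∸ 1) xs) ++ drop (j ∸ 1) xs

-- blocks A = π₁…π_{j-1}, B = π_j…π_{k-1}, C = π_k…πₙ
blockA : ℕ → List ℕ → List ℕ
blockA j xs = take (j ∸ 1) xs

blockB : ℕ → ℕ → List ℕ → List ℕ
blockB j k xs = take (k ∸ j) (drop (j ∸ 1) xs)

blockC : ℕ → List ℕ → List ℕ
blockC k xs = drop (k ∸ 1) xs

prefixTransp : ℕ → ℕ → List ℕ → List ℕ
prefixTransp j k xs = blockB j k xs ++ (blockA j xs ++ blockC k xs)

prefixTransrev : ℕ → ℕ → List ℕ → List ℕ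
prefixTransrev j k xs = blockB j k xs ++ (reverse (blockA j xs) ++ blockC k xs)

data Step (n : ℕ) (xs : List ℕ) : List ℕ → Set where
  rev      : (j : ℕ) → 3 ≤ j → j ≤ n + 1 → Step n xs (prefixRev j xs)
  transp   : (j k : ℕ) → 2 ≤ j → j ≤ n → j < k → k ≤ n + 1 →
             Step n xs (prefixTransp j k xs)
  transrev : (j k : ℕ) → 2 ≤ j → j ≤ n → j < k → k ≤ n + 1 →
             Step n xs (prefixTransrev j k xs)

data Steps (n : ℕ) : ℕ → List ℕ → List ℕ → Set where
  done : ∀ {xs} → Steps n 0 xs xs
  step : ∀ {m xs ys zs} → Step n xs ys → Steps n m ys zs → Steps n (suc m) xs zs

-- d'(π) ≤ m : some sequence of at most m operations sorts π
-- (d'(π) is the minimum such number, so this is exactly "d'(π) ≤ m")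
dist≤ : ℕ → List ℕ → ℕ → Set
dist≤ n xs m = Σ ℕ λ k → k ≤ m × Steps n k xs (oneToN n)

notAdj : ℕ → ℕ → Bool
notAdj a b = if suc a ≡ᵇ b then false else (if suc b ≡ᵇ a then false else true)

adjBreaks : List ℕ → ℕ
adjBreaks [] = 0
adjBreaks (x ∷ []) = 0
adjBreaks (x ∷ y ∷ ys) = (if notAdj x y then 1 else 0) + adjBreaks (y ∷ ys)

-- b(π): position 1 always a breakpoint, plus positions 2..n+1 with |πᵢ - πᵢ₋₁| ≠ 1
breakpoints : ℕ → List ℕ → ℕ
breakpoints n xs = 1 + adjBreaks (drop 1 (extended n xs))

-- Append the sentinel n + 1 to π and count the breakpoints between consecutive entries;
-- this is b(π) − 1, and it vanishes only for the identity. Otherwise let P be the longest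
-- breakpoint-free prefix. P is a run of consecutive values, so some value v outside P is
-- adjacent to an endpoint e of P. If v directly follows P, then e is the first entry of P
-- and reversing P removes the breakpoint behind it. Otherwise move P (reversed if needed)
-- so that e lands next to v: in front of v if the entry p before v is not adjacent to v,
-- behind v if the entry q after v is not. Both cannot be adjacent to v, since e, p, q are
-- distinct (for v = n + 1: p and e would both be n). Every step removes a breakpoint.

module Submission where

open import Defs
open import Data.Bool using (true; false; T; if_then_else_)
open import Data.Empty using (⊥; ⊥-elim)
open import Data.List using (List; []; _∷_; _++_; _∷ʳ_; take; drop; reverse; length; upTo; map; applyUpTo)
open import Data.List.Membership.Propositional using (_∈_; _∉_)
open import Data.List.Membership.Propositional.Properties
  using (∈-++⁺ˡ; ∈-++⁺ʳ; ∈-++⁻; ∈-∃++; ∈-map⁺; ∈-map⁻; ∈-upTo⁺; ∈-upTo⁻)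
open import Data.List.Properties
  using (unfold-reverse; ++-assoc; ++-identityʳ; length-++; length-map; length-upTo; map-upTo)
open import Data.List.Relation.Binary.Permutation.Propositional using (↭-sym; ↭-trans; ↭⇒↭ₛ)
open import Data.List.Relation.Binary.Permutation.Propositional.Properties
  using (∈-resp-↭; ↭-length; shifts; ↭-reverse; ++⁺ˡ; ++⁺ʳ)
import Data.List.Relation.Binary.Permutation.Setoid.Properties as Permutationₛ
open import Data.List.Relation.Unary.All as All using ([]; _∷_)
open import Data.List.Relation.Unary.AllPairs using ([]; _∷_)
open import Data.List.Relation.Unary.Any using (here; there)
open import Data.List.Relation.Unary.Unique.Propositional using (Unique)
import Data.List.Relation.Unary.Unique.Propositional.Properties as Unique
open import Data.Nat using (ℕ; zero; suc; _+_; _∸_; _≤_; _<_; z≤n; s≤s; s≤s⁻¹; _≡ᵇ_)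
open import Data.Nat.Properties
open import Data.Nat.Solver using (module +-*-Solver)
open +-*-Solver using (solve; _:+_; _:=_; con)
open import Data.Product using (_×_; _,_; proj₁; proj₂; ∃-syntax)
open import Data.Sum using (_⊎_; inj₁; inj₂; map₂)
open import Data.Unit using (⊤; tt)
open import Function using (_∘_)
open import Relation.Binary.PropositionalEquality
open import Relation.Nullary using (¬_; yes; no; contradiction)

Adjacent : ℕ → ℕ → Set
Adjacent a b = suc a ≡ b ⊎ suc b ≡ a

Adjacent-sym : ∀ {a b} → Adjacent a b → Adjacent b a
Adjacent-sym (inj₁ e) = inj₂ e
Adjacent-sym (inj₂ e) = inj₁ e

Adjacent-pigeonhole : ∀ {x y z v} → Adjacent x v → Adjacent y v → Adjacent z v →
                      x ≡ y ⊎ x ≡ z ⊎ y ≡ z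
Adjacent-pigeonhole (inj₁ x+1≡v) (inj₁ y+1≡v) _             = inj₁ (suc-injective (trans x+1≡v (sym y+1≡v)))
Adjacent-pigeonhole (inj₂ v+1≡x) (inj₂ v+1≡y) _             = inj₁ (trans (sym v+1≡x) v+1≡y)
Adjacent-pigeonhole (inj₁ x+1≡v) (inj₂ _)     (inj₁ z+1≡v) = inj₂ (inj₁ (suc-injective (trans x+1≡v (sym z+1≡v))))
Adjacent-pigeonhole (inj₁ _)     (inj₂ v+1≡y) (inj₂ v+1≡z) = inj₂ (inj₂ (trans (sym v+1≡y) v+1≡z))
Adjacent-pigeonhole (inj₂ _)     (inj₁ y+1≡v) (inj₁ z+1≡v) = inj₂ (inj₂ (suc-injective (trans y+1≡v (sym z+1≡v))))
Adjacent-pigeonhole (inj₂ v+1≡x) (inj₁ _)     (inj₂ v+1≡z) = inj₂ (inj₁ (trans (sym v+1≡x) v+1≡z))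

Adjacent-suc⇒≡ : ∀ {x n} → x ≤ n → Adjacent x (suc n) → x ≡ n
Adjacent-suc⇒≡ _   (inj₁ x+1≡n+1) = suc-injective x+1≡n+1
Adjacent-suc⇒≡ x≤n (inj₂ refl)    = contradiction (≤-trans (n≤1+n _) x≤n) 1+n≰n

brk : ℕ → ℕ → ℕ
brk a b = if notAdj a b then 1 else 0

brk≤1 : ∀ a b → brk a b ≤ 1
brk≤1 a b with notAdj a b
... | true  = ≤-refl
... | false = z≤n

brk≡0⊎brk≡1 : ∀ a b → brk a b ≡ 0 ⊎ brk a b ≡ 1
brk≡0⊎brk≡1 a b with notAdj a b
... | true  = inj₂ refl
... | false = inj₁ refl

Adjacent⇒brk≡0 : ∀ {a b} → Adjacent a b → brk a b ≡ 0
Adjacent⇒brk≡0 {a} {b} adj with suc a ≡ᵇ b in a+1≟b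
... | true = refl
... | false with adj
...   | inj₁ a+1≡b = contradiction (≡⇒≡ᵇ (suc a) b a+1≡b) (subst T a+1≟b)
...   | inj₂ b+1≡a with suc b ≡ᵇ a in b+1≟a
...     | true  = refl
...     | false = contradiction (≡⇒≡ᵇ (suc b) a b+1≡a) (subst T b+1≟a)

brk≡0⇒Adjacent : ∀ a b → brk a b ≡ 0 → Adjacent a b
brk≡0⇒Adjacent a b brk≡0 with suc a ≡ᵇ b in a+1≟b
... | true = inj₁ (≡ᵇ⇒≡ (suc a) b (subst T (sym a+1≟b) tt))
... | false with suc b ≡ᵇ a in b+1≟a
...   | true = inj₂ (≡ᵇ⇒≡ (suc b) a (subst T (sym b+1≟a) tt))
...   | false with () ← brk≡0

brk≡1⇒¬Adjacent : ∀ {a b} → brk a b ≡ 1 → ¬ Adjacent a b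
brk≡1⇒¬Adjacent broken adj = 0≢1+n (trans (sym (Adjacent⇒brk≡0 adj)) broken)

brk-sym : ∀ a b → brk a b ≡ brk b a
brk-sym a b with brk≡0⊎brk≡1 a b | brk≡0⊎brk≡1 b a
... | inj₁ ab≡0 | _         = trans ab≡0 (sym (Adjacent⇒brk≡0 (Adjacent-sym (brk≡0⇒Adjacent a b ab≡0))))
... | inj₂ ab≡1 | inj₂ ba≡1 = trans ab≡1 (sym ba≡1)
... | inj₂ ab≡1 | inj₁ ba≡0 = contradiction (Adjacent-sym (brk≡0⇒Adjacent b a ba≡0)) (brk≡1⇒¬Adjacent ab≡1)

lastOf : ℕ → List ℕ → ℕ
lastOf x []      = x
lastOf x (y ∷ X) = lastOf y X

headOr : ℕ → List ℕ → ℕ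
headOr s []      = s
headOr s (y ∷ _) = y

lastOf∈ : ∀ x X → lastOf x X ∈ x ∷ X
lastOf∈ x []      = here refl
lastOf∈ x (y ∷ X) = there (lastOf∈ y X)

lastOf-∷ʳ : ∀ x X y → lastOf x (X ∷ʳ y) ≡ y
lastOf-∷ʳ x []      y = refl
lastOf-∷ʳ x (z ∷ X) y = lastOf-∷ʳ z X y

headOr∈∷ʳ : ∀ s Y → headOr s Y ∈ Y ∷ʳ s
headOr∈∷ʳ s []      = here refl
headOr∈∷ʳ s (y ∷ Y) = here refl

∷ʳ-headOr : ∀ s Y → ∃[ Y′ ] Y ∷ʳ s ≡ headOr s Y ∷ Y′
∷ʳ-headOr s []      = [] , refl
∷ʳ-headOr s (y ∷ Y) = Y ∷ʳ s , refl

adjBreaks-++ : ∀ x X y Y →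
  adjBreaks ((x ∷ X) ++ y ∷ Y) ≡ adjBreaks (x ∷ X) + brk (lastOf x X) y + adjBreaks (y ∷ Y)
adjBreaks-++ x []      y Y = refl
adjBreaks-++ x (z ∷ X) y Y = begin
  brk x z + adjBreaks ((z ∷ X) ++ y ∷ Y)
    ≡⟨ cong (brk x z +_) (adjBreaks-++ z X y Y) ⟩
  brk x z + (adjBreaks (z ∷ X) + brk (lastOf z X) y + adjBreaks (y ∷ Y))
    ≡⟨ sym (+-assoc (brk x z) _ _) ⟩
  brk x z + (adjBreaks (z ∷ X) + brk (lastOf z X) y) + adjBreaks (y ∷ Y)
    ≡⟨ cong (_+ adjBreaks (y ∷ Y)) (sym (+-assoc (brk x z) _ _)) ⟩
  brk x z + adjBreaks (z ∷ X) + brk (lastOf z X) y + adjBreaks (y ∷ Y) ∎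
  where open ≡-Reasoning

reverse-∷ : ∀ a A → ∃[ R ] reverse (a ∷ A) ≡ lastOf a A ∷ R
                          × lastOf (lastOf a A) R ≡ a
                          × adjBreaks (lastOf a A ∷ R) ≡ adjBreaks (a ∷ A)
reverse-∷ a []      = [] , refl , refl , refl
reverse-∷ a (b ∷ B) with reverse-∷ b B
... | R , rev≡ , last≡b , breaks≡ = R ∷ʳ a , rev-a∷b∷B , lastOf-∷ʳ _ R a , breaks-rev
  where
  l : ℕ
  l = lastOf b B
  rev-a∷b∷B : reverse (a ∷ b ∷ B) ≡ l ∷ R ∷ʳ a
  rev-a∷b∷B = trans (unfold-reverse a (b ∷ B)) (cong (_∷ʳ a) rev≡)
  breaks-rev : adjBreaks ((l ∷ R) ∷ʳ a) ≡ brk a b + adjBreaks (b ∷ B)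
  breaks-rev = begin
    adjBreaks ((l ∷ R) ∷ʳ a)                         ≡⟨ adjBreaks-++ l R a [] ⟩
    adjBreaks (l ∷ R) + brk (lastOf l R) a + 0       ≡⟨ +-identityʳ _ ⟩
    adjBreaks (l ∷ R) + brk (lastOf l R) a           ≡⟨ cong₂ _+_ breaks≡ (cong (λ t → brk t a) last≡b) ⟩
    adjBreaks (b ∷ B) + brk b a                      ≡⟨ +-comm _ (brk b a) ⟩
    brk b a + adjBreaks (b ∷ B)                      ≡⟨ cong (_+ adjBreaks (b ∷ B)) (brk-sym b a) ⟩
    brk a b + adjBreaks (b ∷ B)                      ∎
    where open ≡-Reasoning

take-length-++ : ∀ (X Y : List ℕ) → take (length X) (X ++ Y) ≡ X
take-length-++ []      Y = refl
take-length-++ (x ∷ X) Y = cong (x ∷_) (take-length-++ X Y)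

drop-length-++ : ∀ (X Y : List ℕ) → drop (length X) (X ++ Y) ≡ Y
drop-length-++ []      Y = refl
drop-length-++ (x ∷ X) Y = drop-length-++ X Y

Unique-++⇒disjoint : ∀ (X : List ℕ) {Y z} → Unique (X ++ Y) → z ∈ X → z ∈ Y → ⊥
Unique-++⇒disjoint (x ∷ X) (x∉ ∷ _) (here refl) z∈Y = All.lookup x∉ (∈-++⁺ʳ X z∈Y) refl
Unique-++⇒disjoint (x ∷ X) (_ ∷ u)  (there z∈X) z∈Y = Unique-++⇒disjoint X u z∈X z∈Y

Unique-++⁻ˡ : ∀ (X : List ℕ) {Y} → Unique (X ++ Y) → Unique X
Unique-++⁻ˡ X {Y} u = subst Unique (take-length-++ X Y) (Unique.take⁺ (length X) u)

Unique-++⁻ʳ : ∀ (X : List ℕ) {Y} → Unique (X ++ Y) → Unique Y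
Unique-++⁻ʳ X {Y} u = subst Unique (drop-length-++ X Y) (Unique.drop⁺ (length X) u)

module IsPerm-properties {n xs} (π : IsPerm n xs) where

  ∈⇒bounded : ∀ {z} → z ∈ xs → 1 ≤ z × z ≤ n
  ∈⇒bounded z∈xs with ∈-map⁻ suc (∈-resp-↭ π z∈xs)
  ... | i , i∈upTo , refl = s≤s z≤n , ∈-upTo⁻ i∈upTo

  bounded⇒∈ : ∀ {z} → 1 ≤ z → z ≤ n → z ∈ xs
  bounded⇒∈ {suc i} _ i<n = ∈-resp-↭ (↭-sym π) (∈-map⁺ suc (∈-upTo⁺ i<n))

  length≡ : length xs ≡ n
  length≡ = trans (↭-length π) (trans (length-map suc (upTo n)) (length-upTo n))

  unique : Unique xs
  unique = Permutationₛ.Unique-resp-↭ (setoid ℕ) (↭⇒↭ₛ (↭-sym π))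
             (Unique.map⁺ suc-injective (Unique.upTo⁺ n))

  unique-∷ʳ : Unique (xs ∷ʳ suc n)
  unique-∷ʳ = Unique.++⁺ unique (All.[] ∷ [])
                λ { (z∈xs , here refl) → 1+n≰n (proj₂ (∈⇒bounded z∈xs)) }

Ascending : ℕ → List ℕ → Set
Ascending x []      = ⊤
Ascending x (y ∷ Y) = y ≡ suc x × Ascending y Y

Descending : ℕ → List ℕ → Set
Descending x []      = ⊤
Descending x (y ∷ Y) = x ≡ suc y × Descending y Y

strip-monotone : ∀ x X → adjBreaks (x ∷ X) ≡ 0 → Unique (x ∷ X) → Ascending x X ⊎ Descending x X
strip-monotone x []          _      _ = inj₁ tt
strip-monotone x (y ∷ [])    breaks _ with brk≡0⇒Adjacent x y (m+n≡0⇒m≡0 (brk x y) breaks)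
... | inj₁ x+1≡y = inj₁ (sym x+1≡y , tt)
... | inj₂ y+1≡x = inj₂ (sym y+1≡x , tt)
strip-monotone x (y ∷ w ∷ W) breaks ((_ ∷ x≢w ∷ _) ∷ u)
  with strip-monotone y (w ∷ W) (m+n≡0⇒n≡0 (brk x y) breaks) u
     | brk≡0⇒Adjacent x y (m+n≡0⇒m≡0 (brk x y) breaks)
... | inj₁ asc@(w≡y+1 , _) | inj₁ x+1≡y = inj₁ (sym x+1≡y , asc)
... | inj₁ (w≡y+1 , _)     | inj₂ y+1≡x = contradiction (trans (sym y+1≡x) (sym w≡y+1)) x≢w
... | inj₂ des@(y≡w+1 , _) | inj₂ y+1≡x = inj₂ (sym y+1≡x , des)
... | inj₂ (y≡w+1 , _)     | inj₁ x+1≡y = contradiction (suc-injective (trans x+1≡y y≡w+1)) x≢w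

ascending-bounds : ∀ x X → Ascending x X → ∀ {z} → z ∈ x ∷ X → x ≤ z × z ≤ lastOf x X
ascending-bounds x []      _         (here refl) = ≤-refl , ≤-refl
ascending-bounds x (_ ∷ Y) (refl , asc) z∈ with z∈
... | here refl = ≤-refl , ≤-trans (n≤1+n x) (proj₂ (ascending-bounds (suc x) Y asc (here refl)))
... | there z∈Y with ascending-bounds (suc x) Y asc z∈Y
...   | x+1≤z , z≤l = ≤-trans (n≤1+n x) x+1≤z , z≤l

descending-bounds : ∀ x X → Descending x X → ∀ {z} → z ∈ x ∷ X → lastOf x X ≤ z × z ≤ x
descending-bounds x       []      _           (here refl) = ≤-refl , ≤-refl
descending-bounds .(suc y) (y ∷ Y) (refl , des) z∈ with z∈
... | here refl = ≤-trans (proj₁ (descending-bounds y Y des (here refl))) (n≤1+n y) , ≤-refl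
... | there z∈Y with descending-bounds y Y des z∈Y
...   | l≤z , z≤y = l≤z , ≤-trans z≤y (n≤1+n y)

applyUpTo-cong : ∀ {f g : ℕ → ℕ} → (∀ i → f i ≡ g i) → ∀ k → applyUpTo f k ≡ applyUpTo g k
applyUpTo-cong f≗g zero    = refl
applyUpTo-cong f≗g (suc k) = cong₂ _∷_ (f≗g 0) (applyUpTo-cong (f≗g ∘ suc) k)

ascending≡applyUpTo : ∀ x X → Ascending x X → x ∷ X ≡ applyUpTo (_+ x) (suc (length X))
ascending≡applyUpTo x []      _            = refl
ascending≡applyUpTo x (_ ∷ Y) (refl , asc) = cong (x ∷_) (begin
  suc x ∷ Y                                    ≡⟨ ascending≡applyUpTo (suc x) Y asc ⟩
  applyUpTo (_+ suc x) (suc (length Y))        ≡⟨ applyUpTo-cong (λ i → +-suc i x) (suc (length Y)) ⟩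
  applyUpTo (λ i → suc (i + x)) (suc (length Y)) ∎)
  where open ≡-Reasoning

prefixRev-step : ∀ {n} X Y → length (X ++ Y) ≡ n → 2 ≤ length X → Step n (X ++ Y) (reverse X ++ Y)
prefixRev-step {n} X Y |XY|≡n 2≤|X| =
  subst (Step n (X ++ Y)) prefixRev≡ (rev (suc (length X)) (s≤s 2≤|X|) j≤n+1)
  where
  prefixRev≡ : prefixRev (suc (length X)) (X ++ Y) ≡ reverse X ++ Y
  prefixRev≡ = cong₂ (λ A C → reverse A ++ C) (take-length-++ X Y) (drop-length-++ X Y)
  j≤n+1 : suc (length X) ≤ n + 1
  j≤n+1 = subst (suc (length X) ≤_) (trans (cong suc (trans (sym (length-++ X)) |XY|≡n)) (+-comm 1 n))
            (s≤s (m≤m+n (length X) (length Y)))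

module PrefixBlocks {n} (X Y Z : List ℕ) (|XYZ|≡n : length (X ++ Y ++ Z) ≡ n)
                    (1≤|X| : 1 ≤ length X) (1≤|Y| : 1 ≤ length Y) where
  private
    j k : ℕ
    j = suc (length X)
    k = suc (length X + length Y)

    n≡ : n ≡ length X + (length Y + length Z)
    n≡ = trans (sym |XYZ|≡n) (trans (length-++ X) (cong (length X +_) (length-++ Y)))

    blockA≡ : blockA j (X ++ Y ++ Z) ≡ X
    blockA≡ = take-length-++ X _

    blockB≡ : blockB j k (X ++ Y ++ Z) ≡ Y
    blockB≡ = trans (cong₂ take (m+n∸m≡n (length X) (length Y)) (drop-length-++ X _)) (take-length-++ Y Z)

    blockC≡ : blockC k (X ++ Y ++ Z) ≡ Z
    blockC≡ = trans (cong₂ drop (sym (length-++ X)) (sym (++-assoc X Y Z))) (drop-length-++ (X ++ Y) Z)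

    2≤j : 2 ≤ j
    2≤j = s≤s 1≤|X|

    j≤n : j ≤ n
    j≤n = subst (j ≤_) (sym n≡) (subst (_≤ length X + (length Y + length Z)) (+-comm (length X) 1)
            (+-monoʳ-≤ (length X) (≤-trans 1≤|Y| (m≤m+n (length Y) (length Z)))))

    j<k : j < k
    j<k = s≤s (subst (_≤ length X + length Y) (+-comm (length X) 1) (+-monoʳ-≤ (length X) 1≤|Y|))

    k≤n+1 : k ≤ n + 1
    k≤n+1 = subst (k ≤_) (trans (cong suc (sym n≡)) (+-comm 1 n))
              (s≤s (+-monoʳ-≤ (length X) (m≤m+n (length Y) (length Z))))

  prefixTransp-step : Step n (X ++ Y ++ Z) (Y ++ X ++ Z)
  prefixTransp-step = subst (Step n (X ++ Y ++ Z)) (cong₂ _++_ blockB≡ (cong₂ _++_ blockA≡ blockC≡))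
                        (transp j k 2≤j j≤n j<k k≤n+1)

  prefixTransrev-step : Step n (X ++ Y ++ Z) (Y ++ reverse X ++ Z)
  prefixTransrev-step = subst (Step n (X ++ Y ++ Z)) (cong₂ _++_ blockB≡ (cong₂ _++_ (cong reverse blockA≡) blockC≡))
                          (transrev j k 2≤j j≤n j<k k≤n+1)

+-exchange-< : ∀ bP bX bY i j → i + j ≤ 1 → bX + i + (bP + j + bY) < bP + 1 + (bX + 1 + bY)
+-exchange-< bP bX bY i j i+j≤1 = subst₂ _<_ (sym lhs≡) (sym rhs≡) (s≤s (+-monoʳ-≤ (bP + bX + bY) i+j≤1))
  where
  lhs≡ : bX + i + (bP + j + bY) ≡ bP + bX + bY + (i + j)
  lhs≡ = solve 5 (λ bP bX bY i j → bX :+ i :+ (bP :+ j :+ bY) := bP :+ bX :+ bY :+ (i :+ j)) refl bP bX bY i j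
  rhs≡ : bP + 1 + (bX + 1 + bY) ≡ suc (bP + bX + bY + 1)
  rhs≡ = solve 3 (λ bP bX bY → bP :+ con 1 :+ (bX :+ con 1 :+ bY) := con 1 :+ (bP :+ bX :+ bY :+ con 1)) refl bP bX bY

brk+brk≤1 : ∀ a b c d → brk a b ≡ 0 ⊎ brk c d ≡ 0 → brk a b + brk c d ≤ 1
brk+brk≤1 a b c d (inj₁ ab≡0) rewrite ab≡0 = brk≤1 c d
brk+brk≤1 a b c d (inj₂ cd≡0) rewrite cd≡0 | +-identityʳ (brk a b) = brk≤1 a b

adjBreaks-move-block : ∀ p P p̃ P̃ x X y Y → adjBreaks (p̃ ∷ P̃) ≡ adjBreaks (p ∷ P) →
  brk (lastOf p P) x ≡ 1 → brk (lastOf x X) y ≡ 1 →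
  brk (lastOf x X) p̃ ≡ 0 ⊎ brk (lastOf p̃ P̃) y ≡ 0 →
  adjBreaks ((x ∷ X) ++ (p̃ ∷ P̃) ++ y ∷ Y) < adjBreaks ((p ∷ P) ++ (x ∷ X) ++ y ∷ Y)
adjBreaks-move-block p P p̃ P̃ x X y Y same-breaks P|X X|Y repaired = begin-strict
  adjBreaks ((x ∷ X) ++ (p̃ ∷ P̃) ++ y ∷ Y)
    ≡⟨ adjBreaks-++ x X p̃ (P̃ ++ y ∷ Y) ⟩
  bX + i + adjBreaks ((p̃ ∷ P̃) ++ y ∷ Y)
    ≡⟨ cong (bX + i +_) (trans (adjBreaks-++ p̃ P̃ y Y) (cong (λ b → b + j + bY) same-breaks)) ⟩
  bX + i + (bP + j + bY)
    <⟨ +-exchange-< bP bX bY i j (brk+brk≤1 (lastOf x X) p̃ (lastOf p̃ P̃) y repaired) ⟩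
  bP + 1 + (bX + 1 + bY)
    ≡⟨ sym (cong₂ (λ b c → bP + b + c) P|X (trans (adjBreaks-++ x X y Y) (cong (λ b → bX + b + bY) X|Y))) ⟩
  bP + brk (lastOf p P) x + adjBreaks ((x ∷ X) ++ y ∷ Y)
    ≡⟨ sym (adjBreaks-++ p P x (X ++ y ∷ Y)) ⟩
  adjBreaks ((p ∷ P) ++ (x ∷ X) ++ y ∷ Y) ∎
  where
  open ≤-Reasoning
  bP bX bY i j : ℕ
  bP = adjBreaks (p ∷ P)
  bX = adjBreaks (x ∷ X)
  bY = adjBreaks (y ∷ Y)
  i = brk (lastOf x X) p̃
  j = brk (lastOf p̃ P̃) y

adjBreaks-repair-junction : ∀ p P p̃ P̃ y Y → adjBreaks (p̃ ∷ P̃) ≡ adjBreaks (p ∷ P) →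
  brk (lastOf p P) y ≡ 1 → brk (lastOf p̃ P̃) y ≡ 0 →
  adjBreaks ((p̃ ∷ P̃) ++ y ∷ Y) < adjBreaks ((p ∷ P) ++ y ∷ Y)
adjBreaks-repair-junction p P p̃ P̃ y Y same-breaks broken repaired = begin-strict
  adjBreaks ((p̃ ∷ P̃) ++ y ∷ Y)   ≡⟨ adjBreaks-++ p̃ P̃ y Y ⟩
  bP̃ + brk (lastOf p̃ P̃) y + bY  ≡⟨ cong₂ (λ b c → b + c + bY) same-breaks repaired ⟩
  bP + 0 + bY                    <⟨ +-monoˡ-< bY (+-monoʳ-< bP (s≤s z≤n)) ⟩
  bP + 1 + bY                    ≡⟨ sym (cong (λ b → bP + b + bY) broken) ⟩
  bP + brk (lastOf p P) y + bY   ≡⟨ sym (adjBreaks-++ p P y Y) ⟩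
  adjBreaks ((p ∷ P) ++ y ∷ Y)   ∎
  where
  open ≤-Reasoning
  bP̃ bP bY : ℕ
  bP̃ = adjBreaks (p̃ ∷ P̃)
  bP = adjBreaks (p ∷ P)
  bY = adjBreaks (y ∷ Y)

-- breaks n xs is definitionally breakpoints n xs ∸ 1.
breaks : ℕ → List ℕ → ℕ
breaks n xs = adjBreaks (xs ∷ʳ suc n)

Reduces : ℕ → List ℕ → Set
Reduces n xs = ∃[ ys ] Step n xs ys × IsPerm n ys × breaks n ys < breaks n xs

Endpoint : ℕ → List ℕ → ℕ → Set
Endpoint a A e = e ≡ a ⊎ e ≡ lastOf a A

Endpoint⇒∈ : ∀ {a A e} → Endpoint a A e → e ∈ a ∷ A
Endpoint⇒∈         (inj₁ refl) = here refl
Endpoint⇒∈ {a} {A} (inj₂ refl) = lastOf∈ a A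

reversal-reduces : ∀ {n} a a′ A R → IsPerm n ((a ∷ a′ ∷ A) ++ R) →
  brk (lastOf a′ A) (headOr (suc n) R) ≡ 1 → brk a (headOr (suc n) R) ≡ 0 →
  Reduces n ((a ∷ a′ ∷ A) ++ R)
reversal-reduces {n} a a′ A R π broken repaired
  with reverse-∷ a (a′ ∷ A) | ∷ʳ-headOr (suc n) R
... | R̃ , rev≡ , last≡a , same-breaks | R′ , R∷ʳ≡ =
  reverse P ++ R , prefixRev-step P R length≡ (s≤s (s≤s z≤n)) , ↭-trans (++⁺ʳ R (↭-reverse P)) π ,
  subst₂ _<_ (cong adjBreaks (sym new≡)) (cong adjBreaks (sym old≡))
    (adjBreaks-repair-junction a (a′ ∷ A) l R̃ y R′ same-breaks broken
      (trans (cong (λ t → brk t y) last≡a) repaired))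
  where
  open IsPerm-properties π using (length≡)
  P : List ℕ
  P = a ∷ a′ ∷ A
  l y : ℕ
  l = lastOf a′ A
  y = headOr (suc n) R
  old≡ : (P ++ R) ∷ʳ suc n ≡ P ++ y ∷ R′
  old≡ = trans (++-assoc P R _) (cong (P ++_) R∷ʳ≡)
  new≡ : (reverse P ++ R) ∷ʳ suc n ≡ (l ∷ R̃) ++ y ∷ R′
  new≡ = trans (++-assoc (reverse P) R _) (cong₂ _++_ rev≡ R∷ʳ≡)

module BlockMove {n} (a : ℕ) (A : List ℕ) (x : ℕ) (X Y : List ℕ)
                 (π : IsPerm n ((a ∷ A) ++ (x ∷ X) ++ Y))
                 (P|X : brk (lastOf a A) x ≡ 1) (X|Y : brk (lastOf x X) (headOr (suc n) Y) ≡ 1) where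
  private
    P Y′ : List ℕ
    P = a ∷ A
    Y′ = proj₁ (∷ʳ-headOr (suc n) Y)
    l y : ℕ
    l = lastOf a A
    y = headOr (suc n) Y

    open IsPerm-properties π using (length≡)
    open PrefixBlocks P (x ∷ X) Y length≡ (s≤s z≤n) (s≤s z≤n)

    sentinel≡ : ∀ U V → (U ++ V ++ Y) ∷ʳ suc n ≡ U ++ V ++ y ∷ Y′
    sentinel≡ U V = trans (++-assoc U (V ++ Y) _)
                      (cong (U ++_) (trans (++-assoc V Y _) (cong (V ++_) (proj₂ (∷ʳ-headOr (suc n) Y)))))

  transposition-reduces : brk (lastOf x X) a ≡ 0 ⊎ brk l y ≡ 0 → Reduces n (P ++ (x ∷ X) ++ Y)
  transposition-reduces repaired =
    (x ∷ X) ++ P ++ Y , prefixTransp-step , ↭-trans (shifts (x ∷ X) P) π ,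
    subst₂ _<_ (cong adjBreaks (sym (sentinel≡ (x ∷ X) P))) (cong adjBreaks (sym (sentinel≡ P (x ∷ X))))
      (adjBreaks-move-block a A a A x X y Y′ refl P|X X|Y repaired)

  transreversal-reduces : brk (lastOf x X) l ≡ 0 ⊎ brk a y ≡ 0 → Reduces n (P ++ (x ∷ X) ++ Y)
  transreversal-reduces repaired with reverse-∷ a A
  ... | R̃ , rev≡ , last≡a , same-breaks =
    (x ∷ X) ++ reverse P ++ Y , prefixTransrev-step ,
    ↭-trans (↭-trans (++⁺ˡ (x ∷ X) (++⁺ʳ Y (↭-reverse P))) (shifts (x ∷ X) P)) π ,
    subst₂ _<_ (cong adjBreaks (sym new≡)) (cong adjBreaks (sym (sentinel≡ P (x ∷ X))))
      (adjBreaks-move-block a A l R̃ x X y Y′ same-breaks P|X X|Y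
        (map₂ (trans (cong (λ t → brk t y) last≡a)) repaired))
    where
    new≡ : ((x ∷ X) ++ reverse P ++ Y) ∷ʳ suc n ≡ (x ∷ X) ++ (l ∷ R̃) ++ y ∷ Y′
    new≡ = trans (sentinel≡ (x ∷ X) (reverse P)) (cong (λ R → (x ∷ X) ++ R ++ y ∷ Y′) rev≡)

  block-move-reduces : ∀ {e} → Endpoint a A e → Adjacent e (lastOf x X) ⊎ Adjacent e y →
                       Reduces n (P ++ (x ∷ X) ++ Y)
  block-move-reduces (inj₁ refl) (inj₁ e~X) = transposition-reduces (inj₁ (Adjacent⇒brk≡0 (Adjacent-sym e~X)))
  block-move-reduces (inj₂ refl) (inj₂ e~y) = transposition-reduces (inj₂ (Adjacent⇒brk≡0 e~y))
  block-move-reduces (inj₂ refl) (inj₁ e~X) = transreversal-reduces (inj₁ (Adjacent⇒brk≡0 (Adjacent-sym e~X)))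
  block-move-reduces (inj₁ refl) (inj₂ e~y) = transreversal-reduces (inj₂ (Adjacent⇒brk≡0 e~y))

free-neighbour : ∀ {n} lo hi (P : List ℕ) → 1 ≤ lo → lo ≤ n → hi ≤ n →
  (∀ {z} → z ∈ P → lo ≤ z × z ≤ hi) →
  ∃[ v ] (Adjacent lo v ⊎ Adjacent hi v) × v ∉ P × 1 ≤ v × v ≤ suc n
free-neighbour (suc zero)     hi P _ _    hi≤n bounds =
  suc hi , inj₂ (inj₁ refl) , (λ v∈P → 1+n≰n (proj₂ (bounds v∈P))) , s≤s z≤n , s≤s hi≤n
free-neighbour (suc (suc lo)) hi P _ lo≤n _    bounds =
  suc lo , inj₁ (inj₂ refl) , (λ v∈P → 1+n≰n (proj₁ (bounds v∈P))) , s≤s z≤n , m≤n⇒m≤1+n (≤-trans (n≤1+n _) lo≤n)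

strip-free-neighbour : ∀ {n} a A R → IsPerm n ((a ∷ A) ++ R) → adjBreaks (a ∷ A) ≡ 0 →
  ∃[ e ] ∃[ v ] Endpoint a A e × Adjacent e v × v ∉ a ∷ A × 1 ≤ v × v ≤ suc n
strip-free-neighbour {n} a A R π strip = choose (strip-monotone a A strip (Unique-++⁻ˡ (a ∷ A) unique))
  where
  open IsPerm-properties π
  l : ℕ
  l = lastOf a A
  a-bounds : 1 ≤ a × a ≤ n
  a-bounds = ∈⇒bounded (here refl)
  l-bounds : 1 ≤ l × l ≤ n
  l-bounds = ∈⇒bounded (∈-++⁺ˡ (lastOf∈ a A))
  choose : Ascending a A ⊎ Descending a A →
           ∃[ e ] ∃[ v ] Endpoint a A e × Adjacent e v × v ∉ a ∷ A × 1 ≤ v × v ≤ suc n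
  choose (inj₁ asc) with free-neighbour a l (a ∷ A) (proj₁ a-bounds) (proj₂ a-bounds) (proj₂ l-bounds)
                           (ascending-bounds a A asc)
  ... | v , inj₁ a~v , rest = a , v , inj₁ refl , a~v , rest
  ... | v , inj₂ l~v , rest = l , v , inj₂ refl , l~v , rest
  choose (inj₂ des) with free-neighbour l a (a ∷ A) (proj₁ l-bounds) (proj₂ l-bounds) (proj₂ a-bounds)
                           (descending-bounds a A des)
  ... | v , inj₁ l~v , rest = l , v , inj₂ refl , l~v , rest
  ... | v , inj₂ a~v , rest = a , v , inj₁ refl , a~v , rest

-- Where v sits in R ∷ʳ s, the part of the extended permutation following the strip.
data Location (s v : ℕ) (R : List ℕ) : Set where
  next  : headOr s R ≡ v → Location s v R
  later : ∀ x X Y → R ≡ (x ∷ X) ++ Y → headOr s Y ≡ v → Location s v R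

locate : ∀ {n} P R {v} → IsPerm n (P ++ R) → v ∉ P → 1 ≤ v → v ≤ suc n → Location (suc n) v R
locate {n} P R {v} π v∉P 1≤v v≤s with v ≟ suc n
locate P []      π v∉P 1≤v v≤s | yes refl = next refl
locate P (x ∷ X) π v∉P 1≤v v≤s | yes refl = later x X [] (sym (++-identityʳ (x ∷ X))) refl
locate P R       π v∉P 1≤v v≤s | no v≢s
  with ∈-++⁻ P (IsPerm-properties.bounded⇒∈ π 1≤v (s≤s⁻¹ (≤∧≢⇒< v≤s v≢s)))
... | inj₁ v∈P = contradiction v∈P v∉P
... | inj₂ v∈R with ∈-∃++ v∈R
...   | []    , C , refl = next refl
...   | x ∷ X , C , refl = later x X (_ ∷ C) refl refl

sentinel-has-one-neighbour : ∀ {n e} a A x X → IsPerm n ((a ∷ A) ++ (x ∷ X)) → e ∈ a ∷ A →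
  Adjacent e (suc n) → Adjacent (lastOf x X) (suc n) → ⊥
sentinel-has-one-neighbour {n} {e} a A x X π e∈P e~s p~s =
  Unique-++⇒disjoint (a ∷ A) unique e∈P (subst (_∈ x ∷ X) (trans p≡n (sym e≡n)) (lastOf∈ x X))
  where
  open IsPerm-properties π
  e≡n : e ≡ n
  e≡n = Adjacent-suc⇒≡ (proj₂ (∈⇒bounded (∈-++⁺ˡ e∈P))) e~s
  p≡n : lastOf x X ≡ n
  p≡n = Adjacent-suc⇒≡ (proj₂ (∈⇒bounded (∈-++⁺ʳ (a ∷ A) (lastOf∈ x X)))) p~s

three-neighbours-impossible : ∀ {n e} a A x X v C → IsPerm n ((a ∷ A) ++ (x ∷ X) ++ v ∷ C) →
  e ∈ a ∷ A → Adjacent e v → Adjacent (lastOf x X) v → Adjacent v (headOr (suc n) C) → ⊥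
three-neighbours-impossible {n} {e} a A x X v C π e∈P e~v p~v v~q =
  distinct (Adjacent-pigeonhole p~v e~v (Adjacent-sym v~q))
  where
  P rest : List ℕ
  P = a ∷ A
  rest = (x ∷ X) ++ v ∷ C ∷ʳ suc n
  unique-ext : Unique (P ++ rest)
  unique-ext = subst Unique (trans (++-assoc P _ _) (cong (P ++_) (++-assoc (x ∷ X) (v ∷ C) _)))
               (IsPerm-properties.unique-∷ʳ π)
  p∈rest : lastOf x X ∈ rest
  p∈rest = ∈-++⁺ˡ (lastOf∈ x X)
  q∈rest : headOr (suc n) C ∈ rest
  q∈rest = ∈-++⁺ʳ (x ∷ X) (there (headOr∈∷ʳ (suc n) C))
  distinct : lastOf x X ≡ e ⊎ lastOf x X ≡ headOr (suc n) C ⊎ e ≡ headOr (suc n) C → ⊥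
  distinct (inj₁ p≡e)        = Unique-++⇒disjoint P unique-ext e∈P (subst (_∈ rest) p≡e p∈rest)
  distinct (inj₂ (inj₂ e≡q)) = Unique-++⇒disjoint P unique-ext e∈P (subst (_∈ rest) (sym e≡q) q∈rest)
  distinct (inj₂ (inj₁ p≡q)) = Unique-++⇒disjoint (x ∷ X) (Unique-++⁻ʳ P unique-ext) (lastOf∈ x X)
                                 (subst (_∈ v ∷ C ∷ʳ suc n) (sym p≡q) (there (headOr∈∷ʳ (suc n) C)))

neighbour-next-reduces : ∀ {n e} a A R → IsPerm n ((a ∷ A) ++ R) →
  brk (lastOf a A) (headOr (suc n) R) ≡ 1 → Endpoint a A e → Adjacent e (headOr (suc n) R) →
  Reduces n ((a ∷ A) ++ R)
neighbour-next-reduces a (a′ ∷ A) R π broken (inj₁ refl) e~v = reversal-reduces a a′ A R π broken (Adjacent⇒brk≡0 e~v)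
neighbour-next-reduces a []       R π broken (inj₁ refl) e~v = contradiction e~v (brk≡1⇒¬Adjacent broken)
neighbour-next-reduces a A        R π broken (inj₂ refl) e~v = contradiction e~v (brk≡1⇒¬Adjacent broken)

neighbour-later-reduces : ∀ {n e} a A x X Y → IsPerm n ((a ∷ A) ++ (x ∷ X) ++ Y) →
  brk (lastOf a A) x ≡ 1 → Endpoint a A e → Adjacent e (headOr (suc n) Y) →
  Reduces n ((a ∷ A) ++ (x ∷ X) ++ Y)
neighbour-later-reduces {n} a A x X Y π P|X end e~v with brk≡0⊎brk≡1 (lastOf x X) (headOr (suc n) Y)
... | inj₂ X|v = BlockMove.block-move-reduces a A x X Y π P|X X|v end (inj₂ e~v)
neighbour-later-reduces {n} a A x X [] π P|X end e~s | inj₁ X~s =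
  ⊥-elim (sentinel-has-one-neighbour a A x X (subst (IsPerm n) (cong ((a ∷ A) ++_) (++-identityʳ (x ∷ X))) π)
            (Endpoint⇒∈ end) e~s (brk≡0⇒Adjacent _ _ X~s))
neighbour-later-reduces {n} a A x X (v ∷ C) π P|X end e~v | inj₁ X~v
  with brk≡0⊎brk≡1 v (headOr (suc n) C)
... | inj₁ v~q = ⊥-elim (three-neighbours-impossible a A x X v C π (Endpoint⇒∈ end) e~v
                           (brk≡0⇒Adjacent _ _ X~v) (brk≡0⇒Adjacent _ _ v~q))
... | inj₂ v|q = subst (Reduces n) regroup
      (BlockMove.block-move-reduces a A x (X ∷ʳ v) C (subst (IsPerm n) (sym regroup) π) P|X
        (subst (λ t → brk t (headOr (suc n) C) ≡ 1) (sym (lastOf-∷ʳ x X v)) v|q)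
        end (inj₁ (subst (Adjacent _) (sym (lastOf-∷ʳ x X v)) e~v)))
  where
  regroup : (a ∷ A) ++ (x ∷ X ∷ʳ v) ++ C ≡ (a ∷ A) ++ (x ∷ X) ++ v ∷ C
  regroup = cong (λ t → (a ∷ A) ++ x ∷ t) (++-assoc X (v ∷ []) C)

strip-reduces : ∀ {n} a A R → IsPerm n ((a ∷ A) ++ R) → adjBreaks (a ∷ A) ≡ 0 →
  brk (lastOf a A) (headOr (suc n) R) ≡ 1 → Reduces n ((a ∷ A) ++ R)
strip-reduces a A R π strip broken with strip-free-neighbour a A R π strip
... | e , v , end , e~v , v∉P , 1≤v , v≤s with locate (a ∷ A) R π v∉P 1≤v v≤s
...   | next y≡v            = neighbour-next-reduces a A R π broken end (subst (Adjacent e) (sym y≡v) e~v)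
...   | later x X Y refl y≡v = neighbour-later-reduces a A x X Y π broken end (subst (Adjacent e) (sym y≡v) e~v)

first-strip : ∀ a T s → adjBreaks ((a ∷ T) ∷ʳ s) ≡ 0
  ⊎ ∃[ A ] ∃[ R ] T ≡ A ++ R × adjBreaks (a ∷ A) ≡ 0 × brk (lastOf a A) (headOr s R) ≡ 1
first-strip a []      s with brk≡0⊎brk≡1 a s
... | inj₁ a~s = inj₁ (trans (+-identityʳ _) a~s)
... | inj₂ a|s = inj₂ ([] , [] , refl , refl , a|s)
first-strip a (t ∷ T) s with brk≡0⊎brk≡1 a t
... | inj₂ a|t = inj₂ ([] , t ∷ T , refl , refl , a|t)
... | inj₁ a~t with first-strip t T s
...   | inj₁ unbroken                           = inj₁ (cong₂ _+_ a~t unbroken)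
...   | inj₂ (A , R , T≡A++R , strip , broken) = inj₂ (t ∷ A , R , cong (t ∷_) T≡A++R , cong₂ _+_ a~t strip , broken)

-- A strip ending at the maximal entry n cannot descend: its first entry would exceed n.
strip-ending-at-max : ∀ {n} a T → a ≤ n → lastOf a T ≡ n → Ascending a T ⊎ Descending a T → Ascending a T
strip-ending-at-max a []      _   _    _                = tt
strip-ending-at-max a (t ∷ T) _   _    (inj₁ asc)       = asc
strip-ending-at-max _ (t ∷ T) a≤n l≡n (inj₂ (refl , des)) =
  contradiction (≤-trans (s≤s (subst (_≤ t) l≡n (proj₁ (descending-bounds t T des (here refl))))) a≤n) 1+n≰n

ascending-from-1≡oneToN : ∀ T → Ascending 1 T → 1 ∷ T ≡ oneToN (length (1 ∷ T))
ascending-from-1≡oneToN T asc = begin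
  1 ∷ T                              ≡⟨ ascending≡applyUpTo 1 T asc ⟩
  applyUpTo (_+ 1) (suc (length T))  ≡⟨ applyUpTo-cong (λ i → +-comm i 1) (suc (length T)) ⟩
  applyUpTo suc (suc (length T))     ≡⟨ sym (map-upTo suc (suc (length T))) ⟩
  oneToN (suc (length T))            ∎
  where open ≡-Reasoning

ascending-permutation-starts-at-1 : ∀ {n} a T → IsPerm n (a ∷ T) → Ascending a T → a ≡ 1
ascending-permutation-starts-at-1 zero          T π asc = contradiction (proj₁ (IsPerm-properties.∈⇒bounded π (here refl))) λ ()
ascending-permutation-starts-at-1 (suc zero)    T π asc = refl
ascending-permutation-starts-at-1 (suc (suc b)) T π asc = contradiction (proj₁ (ascending-bounds _ T asc b+1∈)) 1+n≰n
  where
  open IsPerm-properties π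
  b+1∈ : suc b ∈ suc (suc b) ∷ T
  b+1∈ = bounded⇒∈ (s≤s z≤n) (≤-trans (n≤1+n _) (proj₂ (∈⇒bounded (here refl))))

unbroken⇒sorted : ∀ {n} a T → IsPerm n (a ∷ T) → adjBreaks ((a ∷ T) ∷ʳ suc n) ≡ 0 → a ∷ T ≡ oneToN n
unbroken⇒sorted {n} a T π unbroken = begin
  a ∷ T                    ≡⟨ cong (_∷ T) a≡1 ⟩
  1 ∷ T                    ≡⟨ ascending-from-1≡oneToN T (subst (λ b → Ascending b T) a≡1 asc) ⟩
  oneToN (length (a ∷ T))  ≡⟨ cong oneToN length≡ ⟩
  oneToN n                 ∎
  where
  open ≡-Reasoning
  open IsPerm-properties π
  split : adjBreaks (a ∷ T) + brk (lastOf a T) (suc n) + 0 ≡ 0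
  split = trans (sym (adjBreaks-++ a T (suc n) [])) unbroken
  strip+end : adjBreaks (a ∷ T) + brk (lastOf a T) (suc n) ≡ 0
  strip+end = m+n≡0⇒m≡0 _ split
  last≡n : lastOf a T ≡ n
  last≡n = Adjacent-suc⇒≡ (proj₂ (∈⇒bounded (lastOf∈ a T)))
             (brk≡0⇒Adjacent _ _ (m+n≡0⇒n≡0 (adjBreaks (a ∷ T)) strip+end))
  asc : Ascending a T
  asc = strip-ending-at-max a T (proj₂ (∈⇒bounded (here refl))) last≡n
          (strip-monotone a T (m+n≡0⇒m≡0 _ strip+end) unique)
  a≡1 : a ≡ 1
  a≡1 = ascending-permutation-starts-at-1 a T π asc

sorted-or-reduces : ∀ {n} xs → IsPerm n xs → xs ≡ oneToN n ⊎ Reduces n xs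
sorted-or-reduces {n} []      π = inj₁ (cong oneToN (IsPerm-properties.length≡ π))
sorted-or-reduces {n} (a ∷ T) π with first-strip a T (suc n)
... | inj₁ unbroken                       = inj₁ (unbroken⇒sorted a T π unbroken)
... | inj₂ (A , R , refl , strip , broken) = inj₂ (strip-reduces a A R π strip broken)

sort-within : ∀ fuel {n xs} → IsPerm n xs → breaks n xs ≤ fuel → dist≤ n xs (breaks n xs)
sort-within fuel {xs = xs} π b≤fuel with sorted-or-reduces xs π
... | inj₁ refl = 0 , z≤n , done
sort-within zero       π b≤0      | inj₂ (ys , st , π′ , fewer) = contradiction (≤-trans fewer b≤0) λ ()
sort-within (suc fuel) π b≤fuel+1 | inj₂ (ys , st , π′ , fewer)
  with sort-within fuel π′ (s≤s⁻¹ (≤-trans fewer b≤fuel+1))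
... | k , k≤ , sts = suc k , ≤-trans (s≤s k≤) fewer , step st sts

lemma8 : (n : ℕ) (xs : List ℕ) → IsPerm n xs →
    dist≤ n xs (breakpoints n xs ∸ 1)
lemma8 n xs π = sort-within (breaks n xs) π ≤-refl
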